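{- Let $(G,\beta)$ be an edge-labeled graph (in the setting described in the context) with vertices $v_1,\dots,v_n$, and let $(G',\beta|_{G'})$ be a subgraph of $(G,\beta)$ with the $n-1$ vertices $v_1,\dots,v_{n-1}$ (edge labels and vertex modules inherited from $G$). Then the map $\psi:\hat R_G\to\hat R_{G'}$ defined by $\psi(f_{v_1},\dots,f_{v_{n-1}},f_{v_n})=(f_{v_1},\dots,f_{v_{n-1}})$ is a well-defined $\mathbb{Z}$-module homomorphism whose kernel is $\hat{\mathcal F}_n\cup\{(0,\dots,0)\}$, the set of $n$-th flow-up classes of $\hat R_G$ together with the zero spline. In general, $\psi$ need not be surjective.
   Context: Setting: $G=(V,E)$ is a finite connected graph with vertices $v_1,\dots,v_n$. Each vertex $v$ is labeled by the $\mathbb{Z}$-module $M_v=m_v\mathbb{Z}$ ($m_v\in\mathbb{Z}$), and each edge $e=uv$ is labeled by $\beta(e)=M_e=\mathbb{Z}/r_e\mathbb{Z}$ ($r_e\in\mathbb{Z}$), with the quotient maps $\varphi_u:M_u\to M_e$, $a\mapsto a+r_e\mathbb{Z}$. A spline (extending generalized spline) is a tuple $f=(f_{v_1},\dots,f_{v_n})\in\prod_v M_v$ with $\varphi_u(f_u)=\varphi_v(f_v)$, i.e. $f_u-f_v\in r_e\mathbb{Z}$, for every edge $e=uv$. The set $\hat R_G$ of splines is a $\mathbb{Z}$-module under componentwise operations. An $i$-th flow-up class is a spline $F$ with $f_{v_i}\neq 0$ and $f_{v_s}=0$ for all $s<i$; $\hat{\mathcal F}_i$ denotes the set of $i$-th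 flow-up classes. -}

module Defs where

open import Data.Nat using (ℕ; suc)
open import Data.Fin using (Fin; toℕ; inject₁; fromℕ)
open import Data.Integer using (ℤ; _+_; _*_; _-_; 0ℤ)
open import Data.Integer.Divisibility using (_∣_)
open import Data.List using (List)
open import Data.List.Membership.Propositional using (_∈_)
open import Data.List.Relation.Unary.Any using (Any)
open import Data.Product using (_×_; Σ)
open import Data.Nat using (_<_)
open import Relation.Binary.PropositionalEquality using (_≡_)
open import Relation.Nullary using (¬_)

-- An edge e = uv of a graph on vertices Fin n, labelled by M_e = ℤ / r_e ℤ.
record Edge (n : ℕ) : Set where
  constructor edge
  field
    src : Fin n
    tgt : Fin n
    r   : ℤ

-- Edge-labelled graph on vertices v_1..v_n (= Fin n); vertex v carries
-- the module M_v = m_v ℤ, edges carry ℤ / r_e ℤ.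
record LGraph (n : ℕ) : Set where
  constructor lgraph
  field
    m     : Fin n → ℤ
    edges : List (Edge n)

open LGraph public
open Edge public

data Joins {n : ℕ} (u v : Fin n) (e : Edge n) : Set where
  fwd : src e ≡ u → tgt e ≡ v → Joins u v e
  bwd : src e ≡ v → tgt e ≡ u → Joins u v e

data Path {n : ℕ} (G : LGraph n) : Fin n → Fin n → Set where
  here : ∀ {u} → Path G u u
  step : ∀ {u v w} → Any (Joins u v) (edges G) → Path G v w → Path G u w

Connected : ∀ {n} → LGraph n → Set
Connected G = ∀ u v → Path G u v

IsSpline : ∀ {n} → LGraph n → (Fin n → ℤ) → Set
IsSpline G f = (∀ v → m G v ∣ f v)
             × (∀ e → e ∈ edges G → r e ∣ (f (src e) - f (tgt e)))

IsFlowUp : ∀ {n} → LGraph n → Fin n → (Fin n → ℤ) → Set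
IsFlowUp G i f = IsSpline G f × ¬ (f i ≡ 0ℤ) × (∀ s → toℕ s < toℕ i → f s ≡ 0ℤ)

injectEdge : ∀ {n} → Edge n → Edge (suc n)
injectEdge (edge u v r) = edge (inject₁ u) (inject₁ v) r

IsSubgraphDropLast : ∀ {n} → LGraph n → LGraph (suc n) → Set
IsSubgraphDropLast G' G =
  (∀ v → m G' v ≡ m G (inject₁ v)) × (∀ e → e ∈ edges G' → injectEdge e ∈ edges G)

ψ : ∀ {n} → (Fin (suc n) → ℤ) → (Fin n → ℤ)
ψ f v = f (inject₁ v)

IsZero : ∀ {n} → (Fin n → ℤ) → Set
IsZero f = ∀ v → f v ≡ 0ℤ

-- ψ only forgets the value at v_n, so it visibly preserves the spline
-- conditions of every edge inherited by G' and is linear.  A spline lies in its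
-- kernel iff it vanishes on v_1, …, v_{n-1}; it is then zero or, when its value
-- at v_n is non-zero, an n-th flow-up class.  Surjectivity fails because the
-- edges to v_n can impose conditions invisible in G'.
module Submission where

open import Defs
open import Data.Nat using (ℕ; suc)
open import Data.Fin using (Fin; fromℕ)
open import Data.Integer using (ℤ; _+_; _*_)
open import Data.Product using (_×_; Σ; ∃)
open import Data.Sum using (_⊎_)
open import Relation.Binary.PropositionalEquality using (_≡_)
open import Relation.Nullary using (¬_)
open import Function.Bundles using (_⇔_)

import Data.Nat as ℕ
import Data.Nat.Properties as ℕ
import Data.Nat.Divisibility as ℕ
open import Data.Fin using (zero; suc; toℕ; inject₁; lower₁)
open import Data.Fin.Properties using (toℕ-injective; toℕ-fromℕ; inject₁-lower₁; inject₁ℕ<)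
open import Data.Integer using (0ℤ; 1ℤ; _-_)
open import Data.Integer.Properties using (_≟_; ∣i∣≡0⇒i≡0)
open import Data.Integer.Divisibility using (_∣_)
open import Data.List using ([]; _∷_)
open import Data.List.Relation.Unary.Any using (here)
open import Data.Product using (_,_)
open import Data.Sum using (inj₁; inj₂)
open import Function.Base using (_∘_)
open import Function.Bundles using (mk⇔)
open import Relation.Binary.PropositionalEquality using (refl; sym; trans; cong₂; subst; module ≡-Reasoning)
open import Relation.Nullary using (yes; no; contradiction)
open import Data.Empty using (⊥-elim)

last-or-inject₁ : ∀ {n} (v : Fin (suc n)) → v ≡ fromℕ n ⊎ ∃ λ w → v ≡ inject₁ w
last-or-inject₁ {n} v with n ℕ.≟ toℕ v
... | yes n≡v = inj₁ (toℕ-injective (trans (sym n≡v) (sym (toℕ-fromℕ n))))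
... | no n≢v  = inj₂ (lower₁ v n≢v , sym (inject₁-lower₁ v n≢v))

0∣⇒≡0 : ∀ {i} → 0ℤ ∣ i → i ≡ 0ℤ
0∣⇒≡0 = ∣i∣≡0⇒i≡0 ∘ ℕ.0∣⇒≡0

module _ {n : ℕ} {G : LGraph (suc n)} {G' : LGraph n} where

  ψ-preserves-IsSpline : IsSubgraphDropLast G' G →
                         ∀ f → IsSpline G f → IsSpline G' (ψ f)
  ψ-preserves-IsSpline (m≡ , e∈) f (m∣f , r∣δf) =
      (λ v → subst (_∣ f (inject₁ v)) (sym (m≡ v)) (m∣f (inject₁ v)))
    , (λ e e∈G' → r∣δf (injectEdge e) (e∈ e e∈G'))

module _ {n : ℕ} (f : Fin (suc n) → ℤ) where

  IsZero-ψ⇒vanishes-below-last : IsZero (ψ f) →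
                                 ∀ s → toℕ s ℕ.< toℕ (fromℕ n) → f s ≡ 0ℤ
  IsZero-ψ⇒vanishes-below-last ψf≡0 s s<last with last-or-inject₁ s
  ... | inj₁ refl       = ⊥-elim (ℕ.<-irrefl refl s<last)
  ... | inj₂ (w , refl) = ψf≡0 w

  vanishes-below-last⇒IsZero-ψ : (∀ s → toℕ s ℕ.< toℕ (fromℕ n) → f s ≡ 0ℤ) →
                                 IsZero (ψ f)
  vanishes-below-last⇒IsZero-ψ f<last≡0 w =
    f<last≡0 (inject₁ w) (subst (toℕ (inject₁ w) ℕ.<_) (sym (toℕ-fromℕ n)) (inject₁ℕ< w))

  IsZero-ψ⇒IsZero : IsZero (ψ f) → f (fromℕ n) ≡ 0ℤ → IsZero f
  IsZero-ψ⇒IsZero ψf≡0 f[last]≡0 v with last-or-inject₁ v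
  ... | inj₁ refl       = f[last]≡0
  ... | inj₂ (w , refl) = ψf≡0 w

  kernel-ψ⇔flowUp-or-zero : (G : LGraph (suc n)) → IsSpline G f →
                            IsZero (ψ f) ⇔ (IsFlowUp G (fromℕ n) f ⊎ IsZero f)
  kernel-ψ⇔flowUp-or-zero G spline = mk⇔ to from
    where
    to : IsZero (ψ f) → IsFlowUp G (fromℕ n) f ⊎ IsZero f
    to ψf≡0 with f (fromℕ n) ≟ 0ℤ
    ... | yes f[last]≡0 = inj₂ (IsZero-ψ⇒IsZero ψf≡0 f[last]≡0)
    ... | no  f[last]≢0 = inj₁ (spline , f[last]≢0 , IsZero-ψ⇒vanishes-below-last ψf≡0)
    from : IsFlowUp G (fromℕ n) f ⊎ IsZero f → IsZero (ψ f)
    from (inj₁ (_ , _ , f<last≡0)) = vanishes-below-last⇒IsZero-ψ f<last≡0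
    from (inj₂ f≡0)                = f≡0 ∘ inject₁

-- M_{v₂} = 0ℤ and the edge label ℤ/0ℤ force every spline on this graph to be
-- zero, while G' (the single vertex v₁ with M = ℤ) carries the spline 1.
pinnedEdge : LGraph 2
pinnedEdge = lgraph (λ { zero → 1ℤ ; (suc _) → 0ℤ }) (edge zero (suc zero) 0ℤ ∷ [])

freeVertex : LGraph 1
freeVertex = lgraph (λ _ → 1ℤ) []

pinnedEdge-connected : Connected pinnedEdge
pinnedEdge-connected zero       zero       = here
pinnedEdge-connected zero       (suc zero) = step (here (fwd refl refl)) here
pinnedEdge-connected (suc zero) zero       = step (here (bwd refl refl)) here
pinnedEdge-connected (suc zero) (suc zero) = here

freeVertex-subgraph : IsSubgraphDropLast freeVertex pinnedEdge
freeVertex-subgraph = (λ { zero → refl }) , (λ _ ())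

ψ-not-surjective : ¬ ((g : Fin 1 → ℤ) → IsSpline freeVertex g →
                      Σ (Fin 2 → ℤ) λ f → IsSpline pinnedEdge f × (∀ v → ψ f v ≡ g v))
ψ-not-surjective lift with lift (λ _ → 1ℤ) ((λ _ → ℕ.∣-refl) , (λ _ ()))
... | f , (m∣f , r∣δf) , ψf≡1 = contradiction 1≡0 λ ()
  where
  open ≡-Reasoning
  1≡0 : 1ℤ ≡ 0ℤ
  1≡0 = begin
    1ℤ                    ≡⟨ sym (cong₂ _-_ (ψf≡1 zero) (0∣⇒≡0 (m∣f (suc zero)))) ⟩
    f zero - f (suc zero) ≡⟨ 0∣⇒≡0 (r∣δf _ (here refl)) ⟩
    0ℤ                    ∎

theorem3p2 :
    ((n : ℕ) (G : LGraph (suc n)) (G' : LGraph n) → Connected G → IsSubgraphDropLast G' G →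
      ((f : Fin (suc n) → ℤ) → IsSpline G f → IsSpline G' (ψ f))
      × ((f g : Fin (suc n) → ℤ) → ∀ v → ψ (λ w → f w + g w) v ≡ ψ f v + ψ g v)
      × ((c : ℤ) (f : Fin (suc n) → ℤ) → ∀ v → ψ (λ w → c * f w) v ≡ c * ψ f v)
      × ((f : Fin (suc n) → ℤ) → IsSpline G f →
          (IsZero (ψ f) ⇔ (IsFlowUp G (fromℕ n) f ⊎ IsZero f))))
    × (Σ ℕ λ n → Σ (LGraph (suc n)) λ G → Σ (LGraph n) λ G' →
        Connected G × IsSubgraphDropLast G' G ×
        ¬ ((g : Fin n → ℤ) → IsSpline G' g →
             Σ (Fin (suc n) → ℤ) λ f → IsSpline G f × (∀ v → ψ f v ≡ g v)))
theorem3p2 =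
    (λ n G G' _ G'⊆G →
         ψ-preserves-IsSpline {G = G} G'⊆G
       , (λ f g v → refl)
       , (λ c f v → refl)
       , (λ f → kernel-ψ⇔flowUp-or-zero f G))
  , (1 , pinnedEdge , freeVertex , pinnedEdge-connected , freeVertex-subgraph , ψ-not-surjective)
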